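{- For every positive integer $n$ there exist a positive integer $x_1$ and a positive integer $m$ such that for every $i \in \{0,1,\dots,n-1\}$ we have $Col^{i+1}(x_1) > Col^{i}(x_1)$ and the step size of $Col^{i}(x_1)$ equals $m$.
   Context: The Collatz map $Col$ on the positive integers is defined as follows. If $x$ is odd, $Col(x) = (3x+1)/2^{m}$, where $m \ge 1$ is the exponent of the largest power of $2$ dividing $3x+1$; if $x$ is even, $Col(x) = x/2^{m}$, where $m \ge 1$ is the exponent of the largest power of $2$ dividing $x$. In either case this exponent $m$ is called the step size of $x$. $Col^{0}(x) = x$ and $Col^{i+1}(x) = Col(Col^{i}(x))$. -}

module Defs where

open import Data.Nat using (ℕ; zero; suc; _+_; _*_; _^_; _≡ᵇ_)
open import Data.Nat.DivMod using (_/_; _%_)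
open import Data.Bool using (Bool; true; false; if_then_else_; _∧_; not)

-- 2-adic valuation with fuel: number of times 2 divides n (for n ≥ 1).
-- Fuel n suffices since 2^k ∣ n, n ≥ 1 implies k ≤ n.
v2-fuel : ℕ → ℕ → ℕ
v2-fuel zero    n = 0
v2-fuel (suc f) n =
  if not (n ≡ᵇ 0) ∧ (n % 2 ≡ᵇ 0) then suc (v2-fuel f (n / 2)) else 0

-- exponent of the largest power of 2 dividing n (junk value 0 at n = 0)
v2 : ℕ → ℕ
v2 n = v2-fuel n n

isOdd : ℕ → Bool
isOdd x = x % 2 ≡ᵇ 1

pre : ℕ → ℕ
pre x = if isOdd x then 3 * x + 1 else x

stepSize : ℕ → ℕ
stepSize x = v2 (pre x)

-- divide by 2 k times (exact here since 2^k divides the argument)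
halve : ℕ → ℕ → ℕ
halve zero    y = y
halve (suc k) y = halve k (y / 2)

Col : ℕ → ℕ
Col x = halve (stepSize x) (pre x)

Col^ : ℕ → ℕ → ℕ
Col^ zero    x = x
Col^ (suc i) x = Col (Col^ i x)

{-# OPTIONS --safe #-}
module Submission where

-- A number x with x + 1 = 2^(k+2) · d is ≡ 3 (mod 4), so 3x + 1 is exactly twice an odd
-- number: the step size of x is 1 and Col x = (3x + 1)/2 > x.  Moreover
-- Col x + 1 = 3(x + 1)/2 = 2^(k+1) · 3d, so the 2-adic valuation of x + 1 drops by one
-- per step.  Starting from x₁ = 2^(n+1) − 1 the first n iterates therefore all rise with
-- step size 1.

open import Defs
open import Data.Nat using (ℕ; zero; suc; pred; _+_; _*_; _^_; _<_; _>_; z<s; s≤s; z≤n)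
open import Data.Nat.Properties
  using ( suc-injective; +-suc; *-identityˡ; *-identityʳ; *-assoc; m≤n⇒m≤1+n; +-monoʳ-≤
        ; *-monoʳ-≤; ^-monoʳ-<; m^n≢0; <⇒≤pred; suc-pred; m≤n⇒∃[o]m+o≡n)
open import Data.Nat.DivMod using (_%_; [m+kn]%n≡m%n; m*n%n≡0; m*n/n≡m)
open import Data.Nat.Tactic.RingSolver using (solve-∀)
open import Data.Product using (Σ; ∃; _×_; _,_)
open import Relation.Binary.PropositionalEquality
  using (_≡_; refl; sym; trans; cong; cong₂; subst; module ≡-Reasoning)
open ≡-Reasoning

odd-%2 : ∀ {x} k → x ≡ 1 + k * 2 → x % 2 ≡ 1
odd-%2 k refl = [m+kn]%n≡m%n 1 k 2

v2-fuel-odd : ∀ f y → y % 2 ≡ 1 → v2-fuel f y ≡ 0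
v2-fuel-odd zero    y _     = refl
v2-fuel-odd (suc f) (suc y) y-odd rewrite y-odd = refl

v2-fuel-double : ∀ f y → v2-fuel (suc f) (suc y * 2) ≡ suc (v2-fuel f (suc y))
v2-fuel-double f y rewrite m*n%n≡0 (suc y) 2 ⦃ _ ⦄ | m*n/n≡m (suc y) 2 ⦃ _ ⦄ = refl

v2-double-odd : ∀ y → y % 2 ≡ 1 → v2 (y * 2) ≡ 1
v2-double-odd (suc y) y-odd = trans (v2-fuel-double (suc (y * 2)) y)
                                    (cong suc (v2-fuel-odd (suc (y * 2)) (suc y) y-odd))

pre-odd : ∀ x → x % 2 ≡ 1 → pre x ≡ 3 * x + 1
pre-odd x x-odd rewrite x-odd = refl

3+a*4≡1+[1+a*2]*2 : ∀ a → 3 + a * 4 ≡ 1 + (1 + a * 2) * 2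
3+a*4≡1+[1+a*2]*2 = solve-∀

5+a*6≡1+[2+a*3]*2 : ∀ a → 5 + a * 6 ≡ 1 + (2 + a * 3) * 2
5+a*6≡1+[2+a*3]*2 = solve-∀

3*[3+a*4]+1≡[5+a*6]*2 : ∀ a → 3 * (3 + a * 4) + 1 ≡ (5 + a * 6) * 2
3*[3+a*4]+1≡[5+a*6]*2 = solve-∀

module _ (a : ℕ) where

  pre-3+a*4 : pre (3 + a * 4) ≡ (5 + a * 6) * 2
  pre-3+a*4 = begin
    pre (3 + a * 4)
      ≡⟨ pre-odd (3 + a * 4) (odd-%2 (1 + a * 2) (3+a*4≡1+[1+a*2]*2 a)) ⟩
    3 * (3 + a * 4) + 1     ≡⟨ 3*[3+a*4]+1≡[5+a*6]*2 a ⟩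
    (5 + a * 6) * 2         ∎

  stepSize-3+a*4 : stepSize (3 + a * 4) ≡ 1
  stepSize-3+a*4 = begin
    v2 (pre (3 + a * 4))    ≡⟨ cong v2 pre-3+a*4 ⟩
    v2 ((5 + a * 6) * 2)
      ≡⟨ v2-double-odd (5 + a * 6) (odd-%2 (2 + a * 3) (5+a*6≡1+[2+a*3]*2 a)) ⟩
    1                       ∎

  Col-3+a*4 : Col (3 + a * 4) ≡ 5 + a * 6
  Col-3+a*4 = begin
    halve (stepSize (3 + a * 4)) (pre (3 + a * 4)) ≡⟨ cong₂ halve stepSize-3+a*4 pre-3+a*4 ⟩
    halve 1 ((5 + a * 6) * 2)                      ≡⟨ m*n/n≡m (5 + a * 6) 2 ⟩
    5 + a * 6                                      ∎

  3+a*4<Col : 3 + a * 4 < Col (3 + a * 4)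
  3+a*4<Col = subst (3 + a * 4 <_) (sym Col-3+a*4)
                    (+-monoʳ-≤ 4 (m≤n⇒m≤1+n (*-monoʳ-≤ a (s≤s (s≤s (s≤s (s≤s z≤n)))))))

4*[1+a]≡1+[3+a*4] : ∀ a → 4 * suc a ≡ suc (3 + a * 4)
4*[1+a]≡1+[3+a*4] = solve-∀

1+[5+a*6]≡6*[1+a] : ∀ a → suc (5 + a * 6) ≡ 6 * suc a
1+[5+a*6]≡6*[1+a] = solve-∀

2*[2*p]*d≡4*[p*d] : ∀ p d → 2 * (2 * p) * d ≡ 4 * (p * d)
2*[2*p]*d≡4*[p*d] = solve-∀

6*[p*d]≡2*p*[3*d] : ∀ p d → 6 * (p * d) ≡ 2 * p * (3 * d)
6*[p*d]≡2*p*[3*d] = solve-∀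

1+x≡4*q⇒x≡3+[q-1]*4 : ∀ x q → suc x ≡ 4 * q → ∃ λ a → q ≡ suc a × x ≡ 3 + a * 4
1+x≡4*q⇒x≡3+[q-1]*4 x (suc a) eq = a , refl , suc-injective (trans eq (4*[1+a]≡1+[3+a*4] a))

1+x≡2^[2+k]*d⇒rise : ∀ k d x → suc x ≡ 2 ^ (2 + k) * d →
                      stepSize x ≡ 1 × x < Col x × suc (Col x) ≡ 2 ^ (1 + k) * (3 * d)
1+x≡2^[2+k]*d⇒rise k d x eq
  with 1+x≡4*q⇒x≡3+[q-1]*4 x (2 ^ k * d) (trans eq (2*[2*p]*d≡4*[p*d] (2 ^ k) d))
... | a , q≡1+a , refl = stepSize-3+a*4 a , 3+a*4<Col a , (begin
  suc (Col (3 + a * 4))  ≡⟨ cong suc (Col-3+a*4 a) ⟩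
  suc (5 + a * 6)        ≡⟨ 1+[5+a*6]≡6*[1+a] a ⟩
  6 * suc a              ≡⟨ cong (6 *_) q≡1+a ⟨
  6 * (2 ^ k * d)        ≡⟨ 6*[p*d]≡2*p*[3*d] (2 ^ k) d ⟩
  2 ^ (1 + k) * (3 * d)  ∎)

suc-Col^ : ∀ i k d x → suc x ≡ 2 ^ (i + suc k) * d → suc (Col^ i x) ≡ 2 ^ suc k * (3 ^ i * d)
suc-Col^ zero    k d x eq = trans eq (cong (2 ^ suc k *_) (sym (*-identityˡ d)))
suc-Col^ (suc i) k d x eq =
  let _ , _ , next = 1+x≡2^[2+k]*d⇒rise k (3 ^ i * d) (Col^ i x) (suc-Col^ i (suc k) d x eq′)
  in trans next (cong (2 ^ suc k *_) (sym (*-assoc 3 (3 ^ i) d)))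
  where
  eq′ : suc x ≡ 2 ^ (i + suc (suc k)) * d
  eq′ = trans eq (cong (λ e → 2 ^ e * d) (sym (+-suc i (suc k))))

Col^-rises : ∀ i k d x → suc x ≡ 2 ^ (i + suc (suc k)) * d →
             Col^ i x < Col^ (suc i) x × stepSize (Col^ i x) ≡ 1
Col^-rises i k d x eq =
  let step , rise , _ = 1+x≡2^[2+k]*d⇒rise k (3 ^ i * d) (Col^ i x) (suc-Col^ i (suc k) d x eq)
  in rise , step

theorem1 : (n : ℕ) → n > 0 →
    Σ ℕ λ x₁ → Σ ℕ λ m → x₁ > 0 × m > 0 ×
      ((i : ℕ) → i < n →
        (Col^ (suc i) x₁ > Col^ i x₁) × (stepSize (Col^ i x₁) ≡ m))
theorem1 n _ = x₁ , 1 , x₁>0 , s≤s z≤n , rises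
  where
  x₁ : ℕ
  x₁ = pred (2 ^ suc n)

  x₁>0 : x₁ > 0
  x₁>0 = <⇒≤pred (^-monoʳ-< 2 (s≤s (s≤s z≤n)) {0} {suc n} z<s)

  x₁+1 : suc x₁ ≡ 2 ^ suc n * 1
  x₁+1 = trans (suc-pred (2 ^ suc n) ⦃ m^n≢0 2 (suc n) ⦄) (sym (*-identityʳ _))

  rises : (i : ℕ) → i < n → Col^ i x₁ < Col^ (suc i) x₁ × stepSize (Col^ i x₁) ≡ 1
  rises i i<n with m≤n⇒∃[o]m+o≡n i<n
  ... | k , i+1+k≡n = Col^-rises i k 1 x₁ (subst (λ e → suc x₁ ≡ 2 ^ e * 1) e≡ x₁+1)
    where
    e≡ : suc n ≡ i + suc (suc k)
    e≡ = sym (trans (+-suc i (suc k)) (cong suc (trans (+-suc i k) i+1+k≡n)))
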